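{- Let $n,k,s,p$ be integers, $s\ge 2$, $p\ge1$, such that $m(n,k,s,(k-1)s+p)$ and $m(n+1,k,s,(k-1)s+p+1)$ are defined. If $m(n,k,s,(k-1)s+p)=\binom{n}{k}-\binom{n-p}{k}$, then $$m(n+1,k,s,(k-1)s+p+1)=\binom{n+1}{k}-\binom{n-p}{k}.$$
   Context: A family $\mathcal F\subset\binom{[n]}{k}$ ($k$-subsets of $[n]=\{1,\ldots,n\}$) has property $U(s,q)$ if $|F_1\cup\ldots\cup F_s|\le q$ for all $F_1,\ldots,F_s\in\mathcal F$ (not necessarily distinct). For integers $n>q\ge k$, $sk>q$, $s\ge2$, $m(n,k,s,q)$ denotes the maximum of $|\mathcal F|$ over all $\mathcal F\subset\binom{[n]}{k}$ with property $U(s,q)$. -}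

module Defs where

open import Data.Nat using (ℕ; _+_; _*_; _∸_; _≤_; _<_)
open import Data.Product using (Σ; _×_)
open import Data.Fin using (Fin)
open import Data.Fin.Subset using (Subset; ∣_∣; ⋃)
open import Data.List using (List; length)
open import Data.List.Membership.Propositional using (_∈_)
open import Data.List.Relation.Unary.All using (All)
open import Data.List.Relation.Unary.Unique.Propositional using (Unique)
open import Data.Vec.Functional using (toList)
open import Relation.Binary.PropositionalEquality using (_≡_)

record Family (n k : ℕ) : Set where
  constructor family
  field
    members : List (Subset n)
    unique  : Unique members
    uniform : All (λ F → ∣ F ∣ ≡ k) members

size : ∀ {n k} → Family n k → ℕ
size 𝓕 = length (Family.members 𝓕)

-- Property U(s,q): for all F₁,…,Fₛ ∈ 𝓕 (not necessarily distinct),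
-- |F₁ ∪ … ∪ Fₛ| ≤ q.
PropU : ∀ {n k} → (s q : ℕ) → Family n k → Set
PropU {n} s q 𝓕 =
  (F : Fin s → Subset n) → (∀ i → F i ∈ Family.members 𝓕) → ∣ ⋃ (toList F) ∣ ≤ q

Defined : (n k s q : ℕ) → Set
Defined n k s q = (q < n) × (k ≤ q) × (q < s * k) × (2 ≤ s)

IsM : (n k s q v : ℕ) → Set
IsM n k s q v =
  Σ (Family n k) (λ 𝓕 → PropU s q 𝓕 × size 𝓕 ≡ v)
  × ((𝓕 : Family n k) → PropU s q 𝓕 → size 𝓕 ≤ v)

module Submission where

-- Write k = r+1 and Q = (k-1)s + p, and regard [n+1] as [n] together with a new
-- point 0 (the index 'zero' of Fin (suc n)).
--
-- The k-subsets of [n+1] meeting the first p+1 points are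
-- C(n+1,k) - C(n-p,k) in number, and s of them cover at most those p+1 points
-- plus at most k-1 further points each, i.e. at most Q+1 points.
--
-- Let 𝓕 be a k-uniform family on [n+1] with U(s,Q+1).  Shifting a
-- point y of [n] to 0 (replace each F ∌ 0, y ∈ F by F-y+0 unless that set is
-- already in 𝓕) preserves size, uniformity and U(s,Q+1), and strictly decreases
-- the number of members avoiding 0; so we may assume 𝓕 is stable under every such
-- shift.  Then the deletion of 0 (the members avoiding 0) has U(s,Q): s of its
-- members are either pairwise disjoint, covering sk > Q+1 points, or two of them
-- share a point y, and moving y to 0 in one of them yields s members of 𝓕 covering
-- one point more.  Hence |𝓕| ≤ |link| + |deletion| ≤ C(n,k-1) + m(n,k,s,Q),
-- which equals C(n+1,k) - C(n-p,k) by Pascal's rule.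

open import Defs
open import Data.Nat using (ℕ; zero; suc; _+_; _*_; _∸_; _≤_; _<_; z≤n; s≤s)
open import Data.Nat.Properties
open import Data.Nat.Combinatorics using (_C_; nCk+nC[k+1]≡[n+1]C[k+1])
open import Data.Nat.Tactic.RingSolver using (solve-∀)
import Data.Bool.Properties as Bool
open import Data.Fin using (Fin; zero; suc)
open import Data.Fin.Properties using (any?) renaming (_≟_ to _≟ᶠ_; suc-injective to sucᶠ-injective)
open import Data.Fin.Subset
  using (Subset; Side; inside; outside; ∣_∣; ⋃; _∪_; _∩_; ⊥; ⁅_⁆; _-_; _∈_; _∉_; _⊆_; Empty)
open import Data.Fin.Subset.Properties
  using ( _∈?_; nonempty?; drop-there; ∉⊥; x∈⁅x⁆; ∣⁅x⁆∣≡1; ∣⊥∣≡0; Empty-unique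
        ; p─⊥≡p; p─q⊆p; x∈p∧x≢y⇒x∈p-y; p⊆q⇒∣p∣≤∣q∣; ⊆-antisym
        ; p⊆p∪q; q⊆p∪q; x∈p∪q⁺; x∈p∪q⁻; x∈p∩q⁻ )
open import Data.Vec using ([]; _∷_) renaming (here to hereˢ; there to thereˢ)
open import Data.Vec.Properties using (≡-dec; ∷-injectiveʳ)
open import Data.Vec.Functional using (toList; updateAt)
open import Data.Vec.Functional.Properties using (updateAt-updates; updateAt-minimal)
open import Data.List using (List; []; _∷_; length; map; _++_)
open import Data.Nat.ListAction using (sum)
open import Data.List.Properties using (length-map; length-++)
open import Data.List.Membership.Propositional using (find; lose)
  renaming (_∈_ to _∈ₗ_; _∉_ to _∉ₗ_)
open import Data.List.Membership.Propositional.Properties using (∈-map⁻)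
import Data.List.Membership.DecPropositional as DecMembership
open import Data.List.Relation.Unary.Any using (here; there)
import Data.List.Relation.Unary.Any as Any
open import Data.List.Relation.Unary.All as All using (All; []; _∷_)
import Data.List.Relation.Unary.All.Properties as All
open import Data.List.Relation.Unary.AllPairs using ([]; _∷_)
open import Data.List.Relation.Unary.Unique.Propositional using (Unique)
import Data.List.Relation.Unary.Unique.Propositional.Properties as Unique
open import Data.Product using (∃-syntax; _×_; _,_; proj₁; proj₂)
open import Data.Sum using (_⊎_; inj₁; inj₂)
open import Function using (_∘_; const)
open import Relation.Nullary using (¬_; Dec; yes; no; contradiction)
open import Relation.Nullary.Decidable using (_×-dec_; ¬?; decidable-stable)
open import Relation.Binary.PropositionalEquality

private
  variable
    m n r s k q : ℕ

∣p∪q∣+∣p∩q∣ : (p q : Subset m) → ∣ p ∪ q ∣ + ∣ p ∩ q ∣ ≡ ∣ p ∣ + ∣ q ∣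
∣p∪q∣+∣p∩q∣ []            []            = refl
∣p∪q∣+∣p∩q∣ (inside  ∷ p) (inside  ∷ q) =
  cong suc (trans (+-suc ∣ p ∪ q ∣ ∣ p ∩ q ∣)
                  (trans (cong suc (∣p∪q∣+∣p∩q∣ p q)) (sym (+-suc ∣ p ∣ ∣ q ∣))))
∣p∪q∣+∣p∩q∣ (inside  ∷ p) (outside ∷ q) = cong suc (∣p∪q∣+∣p∩q∣ p q)
∣p∪q∣+∣p∩q∣ (outside ∷ p) (inside  ∷ q) =
  trans (cong suc (∣p∪q∣+∣p∩q∣ p q)) (sym (+-suc ∣ p ∣ ∣ q ∣))
∣p∪q∣+∣p∩q∣ (outside ∷ p) (outside ∷ q) = ∣p∪q∣+∣p∩q∣ p q

∣p∪q∣≤∣p∣+∣q∣ : (p q : Subset m) → ∣ p ∪ q ∣ ≤ ∣ p ∣ + ∣ q ∣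
∣p∪q∣≤∣p∣+∣q∣ p q = ≤-trans (m≤m+n ∣ p ∪ q ∣ ∣ p ∩ q ∣) (≤-reflexive (∣p∪q∣+∣p∩q∣ p q))

disjoint⇒∣p∪q∣ : (p q : Subset m) → Empty (p ∩ q) → ∣ p ∪ q ∣ ≡ ∣ p ∣ + ∣ q ∣
disjoint⇒∣p∪q∣ {m} p q p∩q-empty = begin
  ∣ p ∪ q ∣              ≡⟨ +-identityʳ ∣ p ∪ q ∣ ⟨
  ∣ p ∪ q ∣ + 0          ≡⟨ cong (∣ p ∪ q ∣ +_) ∣p∩q∣≡0 ⟨
  ∣ p ∪ q ∣ + ∣ p ∩ q ∣  ≡⟨ ∣p∪q∣+∣p∩q∣ p q ⟩
  ∣ p ∣ + ∣ q ∣          ∎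
  where
  open ≡-Reasoning
  ∣p∩q∣≡0 : ∣ p ∩ q ∣ ≡ 0
  ∣p∩q∣≡0 = trans (cong ∣_∣ (Empty-unique p∩q-empty)) (∣⊥∣≡0 m)

suc∣p-x∣≡∣p∣ : {x : Fin m} {p : Subset m} → x ∈ p → suc ∣ p - x ∣ ≡ ∣ p ∣
suc∣p-x∣≡∣p∣ {x = zero}  {inside  ∷ p} _         = cong (suc ∘ ∣_∣) (p─⊥≡p p)
suc∣p-x∣≡∣p∣ {x = suc x} {inside  ∷ p} (thereˢ x∈p) = cong suc (suc∣p-x∣≡∣p∣ x∈p)
suc∣p-x∣≡∣p∣ {x = suc x} {outside ∷ p} (thereˢ x∈p) = suc∣p-x∣≡∣p∣ x∈p

x∉p-x : (x : Fin m) (p : Subset m) → x ∉ p - x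
x∉p-x zero    (_ ∷ p) ()
x∉p-x (suc x) (_ ∷ p) (thereˢ x∈p-x) = x∉p-x x p x∈p-x

-x-injective : {x : Fin m} {p q : Subset m} → x ∈ p → x ∈ q → p - x ≡ q - x → p ≡ q
-x-injective {x = x} {p} {q} x∈p x∈q eq = ⊆-antisym (transfer x∈q eq) (transfer x∈p (sym eq))
  where
  transfer : {a b : Subset _} → x ∈ b → a - x ≡ b - x → a ⊆ b
  transfer {a} {b} x∈b e {z} z∈a with z ≟ᶠ x
  ... | yes refl = x∈b
  ... | no  z≢x  = p─q⊆p b ⁅ x ⁆ (subst (z ∈_) e (x∈p∧x≢y⇒x∈p-y z∈a z≢x))

exchange-≤ : {A B : Subset m} {x y : Fin m} → y ∈ B → A ⊆ ⁅ x ⁆ ∪ (B - y) → ∣ A ∣ ≤ ∣ B ∣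
exchange-≤ {A = A} {B} {x} {y} y∈B A⊆ = begin
  ∣ A ∣                    ≤⟨ p⊆q⇒∣p∣≤∣q∣ A⊆ ⟩
  ∣ ⁅ x ⁆ ∪ (B - y) ∣      ≤⟨ ∣p∪q∣≤∣p∣+∣q∣ ⁅ x ⁆ (B - y) ⟩
  ∣ ⁅ x ⁆ ∣ + ∣ B - y ∣    ≡⟨ cong (_+ ∣ B - y ∣) (∣⁅x⁆∣≡1 x) ⟩
  suc ∣ B - y ∣            ≡⟨ suc∣p-x∣≡∣p∣ y∈B ⟩
  ∣ B ∣                    ∎
  where open ≤-Reasoning

⊆-split : {A C : Subset (suc n)} → (zero ∈ A → zero ∈ C) → (∀ {x} → suc x ∈ A → suc x ∈ C) → A ⊆ C
⊆-split at0 _         {zero}  = at0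
⊆-split _   elsewhere {suc x} = elsewhere

∉0⇒outside : (F : Subset (suc n)) → zero ∉ F → ∃[ u ] F ≡ outside ∷ u
∉0⇒outside (inside  ∷ u) 0∉F = contradiction hereˢ 0∉F
∉0⇒outside (outside ∷ u) _   = u , refl

⋃ᵛ : (Fin s → Subset m) → Subset m
⋃ᵛ G = ⋃ (toList G)

∈⋃ᵛ⁺ : (G : Fin s → Subset m) (i : Fin s) → G i ⊆ ⋃ᵛ G
∈⋃ᵛ⁺ G zero    = p⊆p∪q (⋃ᵛ (G ∘ suc))
∈⋃ᵛ⁺ G (suc i) = q⊆p∪q (G zero) (⋃ᵛ (G ∘ suc)) ∘ ∈⋃ᵛ⁺ (G ∘ suc) i

∈⋃ᵛ⁻ : {s : ℕ} (G : Fin s → Subset m) {x : Fin m} → x ∈ ⋃ᵛ G → ∃[ i ] x ∈ G i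
∈⋃ᵛ⁻ {s = zero}  G x∈⋃ = contradiction x∈⋃ ∉⊥
∈⋃ᵛ⁻ {s = suc s} G x∈⋃ with x∈p∪q⁻ (G zero) (⋃ᵛ (G ∘ suc)) x∈⋃
... | inj₁ x∈G₀ = zero , x∈G₀
... | inj₂ x∈⋃′ with ∈⋃ᵛ⁻ (G ∘ suc) x∈⋃′
...   | i , x∈Gi = suc i , x∈Gi

⋃ᵛ-outside : {s : ℕ} (G : Fin s → Subset m) → ⋃ᵛ (λ i → outside ∷ G i) ≡ outside ∷ ⋃ᵛ G
⋃ᵛ-outside {s = zero}  G = refl
⋃ᵛ-outside {s = suc s} G = cong ((outside ∷ G zero) ∪_) (⋃ᵛ-outside (G ∘ suc))

Overlap : (Fin s → Subset m) → Set
Overlap G = ∃[ i ] ∃[ j ] ∃[ x ] i ≢ j × x ∈ G i × x ∈ G j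

overlap-or-disjoint : {s : ℕ} (G : Fin s → Subset m) → (∀ i → ∣ G i ∣ ≡ k) →
                      Overlap G ⊎ ∣ ⋃ᵛ G ∣ ≡ s * k
overlap-or-disjoint {m = m} {s = zero} G _ = inj₂ (∣⊥∣≡0 m)
overlap-or-disjoint {s = suc s} G size with overlap-or-disjoint (G ∘ suc) (size ∘ suc)
... | inj₁ (i , j , x , i≢j , x∈Gi , x∈Gj) =
  inj₁ (suc i , suc j , x , i≢j ∘ sucᶠ-injective , x∈Gi , x∈Gj)
... | inj₂ ∣rest∣ with nonempty? (G zero ∩ ⋃ᵛ (G ∘ suc))
...   | yes (x , x∈∩) =
  let x∈G₀ , x∈rest = x∈p∩q⁻ (G zero) (⋃ᵛ (G ∘ suc)) x∈∩
      j , x∈Gj      = ∈⋃ᵛ⁻ (G ∘ suc) x∈rest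
  in inj₁ (zero , suc j , x , (λ ()) , x∈G₀ , x∈Gj)
...   | no disjoint =
  inj₂ (trans (disjoint⇒∣p∪q∣ (G zero) (⋃ᵛ (G ∘ suc)) disjoint) (cong₂ _+_ (size zero) ∣rest∣))

moveTo0 : Subset n → Fin n → Subset (suc n)
moveTo0 v y = inside ∷ (v - y)

move-covers : (G : Fin s → Subset (suc n)) {i j : Fin s} {b : Side} {u : Subset n} {y : Fin n} →
              i ≢ j → G i ≡ b ∷ u → suc y ∈ G j →
              let G′ = updateAt G i (const (moveTo0 u y)) in zero ∈ ⋃ᵛ G′ × ⋃ᵛ G ⊆ ⋃ᵛ G′
move-covers G {i} {j} {u = u} {y} i≢j Gi≡ sy∈Gj = 0∈⋃G′ , ⊆-split (λ _ → 0∈⋃G′) covered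
  where
  G′ = updateAt G i (const (moveTo0 u y))
  G′i≡ : G′ i ≡ moveTo0 u y
  G′i≡ = updateAt-updates i G
  0∈⋃G′ : zero ∈ ⋃ᵛ G′
  0∈⋃G′ = ∈⋃ᵛ⁺ G′ i (subst (zero ∈_) (sym G′i≡) hereˢ)
  covered : ∀ {x} → suc x ∈ ⋃ᵛ G → suc x ∈ ⋃ᵛ G′
  covered {x} sx∈⋃ with x ≟ᶠ y | ∈⋃ᵛ⁻ G sx∈⋃
  ... | yes refl | _ = ∈⋃ᵛ⁺ G′ j (subst (suc y ∈_) (sym (updateAt-minimal j i G (i≢j ∘ sym))) sy∈Gj)
  ... | no  x≢y  | l , sx∈Gl with l ≟ᶠ i
  ...   | no  l≢i  = ∈⋃ᵛ⁺ G′ l (subst (suc x ∈_) (sym (updateAt-minimal l i G l≢i)) sx∈Gl)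
  ...   | yes refl = ∈⋃ᵛ⁺ G′ i (subst (suc x ∈_) (sym G′i≡)
                       (thereˢ (x∈p∧x≢y⇒x∈p-y (drop-there (subst (suc x ∈_) Gi≡ sx∈Gl)) x≢y)))

-- U(s,q) for the members of a list; PropU s q 𝓕 unfolds to this for members 𝓕.
UnionBound : ℕ → ℕ → List (Subset m) → Set
UnionBound {m} s q L = (F : Fin s → Subset m) → (∀ i → F i ∈ₗ L) → ∣ ⋃ᵛ F ∣ ≤ q

covered-≤ : {L : List (Subset m)} → UnionBound s q L →
            (F : Fin s → Subset m) → (∀ i → F i ∈ₗ L) → {A : Subset m} → A ⊆ ⋃ᵛ F → ∣ A ∣ ≤ q
covered-≤ U F F∈L A⊆ = ≤-trans (p⊆q⇒∣p∣≤∣q∣ A⊆) (U F F∈L)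

updateAt-∈ : {L : List (Subset m)} (F : Fin s → Subset m) (i : Fin s) {X : Subset m} →
             (∀ l → F l ∈ₗ L) → X ∈ₗ L → ∀ l → updateAt F i (const X) l ∈ₗ L
updateAt-∈ {L = L} F i F∈L X∈L l with l ≟ᶠ i
... | yes refl = subst (_∈ₗ L) (sym (updateAt-updates i F)) X∈L
... | no  l≢i  = subst (_∈ₗ L) (sym (updateAt-minimal l i F l≢i)) (F∈L l)

part : Side → List (Subset (suc n)) → List (Subset n)
part b []             = []
part b ((c ∷ v) ∷ L) with b Bool.≟ c
... | yes _ = v ∷ part b L
... | no  _ = part b L

length-part : (L : List (Subset (suc n))) →
              length L ≡ length (part inside L) + length (part outside L)
length-part []                  = refl
length-part ((inside  ∷ v) ∷ L) = cong suc (length-part L)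
length-part ((outside ∷ v) ∷ L) =
  trans (cong suc (length-part L)) (sym (+-suc (length (part inside L)) (length (part outside L))))

∈-part⁻ : (b : Side) (L : List (Subset (suc n))) {v : Subset n} → v ∈ₗ part b L → (b ∷ v) ∈ₗ L
∈-part⁻ b ((c ∷ w) ∷ L) v∈ with b Bool.≟ c | v∈
... | yes refl | here refl = here refl
... | yes refl | there v∈′ = there (∈-part⁻ b L v∈′)
... | no  _    | v∈′       = there (∈-part⁻ b L v∈′)

∈-part⁺ : (b : Side) (L : List (Subset (suc n))) {v : Subset n} → (b ∷ v) ∈ₗ L → v ∈ₗ part b L
∈-part⁺ b ((c ∷ w) ∷ L) bv∈ with b Bool.≟ c | bv∈
... | yes refl | here refl = here refl
... | yes refl | there bv∈′ = there (∈-part⁺ b L bv∈′)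
... | no  b≢c  | here refl = contradiction refl b≢c
... | no  _    | there bv∈′ = ∈-part⁺ b L bv∈′

part-unique : (b : Side) (L : List (Subset (suc n))) → Unique L → Unique (part b L)
part-unique b []             []            = []
part-unique b ((c ∷ v) ∷ L) (v∉L ∷ unique) with b Bool.≟ c
... | yes refl =
  All.tabulate (λ w∈ v≡w → All.lookup v∉L (∈-part⁻ b L w∈) (cong (b ∷_) v≡w)) ∷ part-unique b L unique
... | no _ = part-unique b L unique

part-All : {P : Subset (suc n) → Set} (b : Side) (L : List (Subset (suc n))) →
           All P L → All (λ v → P (b ∷ v)) (part b L)
part-All b L all = All.tabulate (All.lookup all ∘ ∈-part⁻ b L)

length-All-absurd : {A : Set} {P : A → Set} {L : List A} → (∀ {x} → ¬ P x) → All P L → length L ≡ 0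
length-All-absurd ¬P []      = refl
length-All-absurd ¬P (p ∷ _) = contradiction p ¬P

map-unique : {A B : Set} {f : A → B} {xs : List A} →
             (∀ {x y} → x ∈ₗ xs → y ∈ₗ xs → f x ≡ f y → x ≡ y) → Unique xs → Unique (map f xs)
map-unique {xs = []}     _   []            = []
map-unique {xs = x ∷ xs} inj (x∉xs ∷ uniq) =
  All.map⁺ (All.tabulate (λ y∈ fx≡fy → All.lookup x∉xs y∈ (inj (here refl) (there y∈) fx≡fy)))
  ∷ map-unique (λ x∈ y∈ → inj (there x∈) (there y∈)) uniq

deletion : Family (suc n) k → Family n k
deletion (family L unique uniform) =
  family (part outside L) (part-unique outside L unique) (part-All outside L uniform)

link : Family (suc n) (suc k) → Family n k
link (family L unique uniform) =
  family (part inside L) (part-unique inside L unique)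
         (All.map suc-injective (part-All inside L uniform))

size-split : (𝓕 : Family (suc n) (suc k)) → size 𝓕 ≡ size (link 𝓕) + size (deletion 𝓕)
size-split (family L _ _) = length-part L

size≤C : (𝓕 : Family n k) → size 𝓕 ≤ n C k
size≤C {zero} {zero} (family []           _ _) = z≤n
size≤C {zero} {zero} (family (_ ∷ [])     _ _) = ≤-refl
size≤C {zero} {zero} (family ([] ∷ [] ∷ _) ((distinct ∷ _) ∷ _) _) = contradiction refl distinct
size≤C {zero} {suc k} (family L _ uniform) = ≤-reflexive (length-All-absurd (λ { {[]} () }) uniform)
size≤C {suc n} {zero} 𝓕@(family L _ uniform) = begin
  length L                                          ≡⟨ length-part L ⟩
  length (part inside L) + size (deletion 𝓕)        ≡⟨ cong (_+ size (deletion 𝓕)) no-link ⟩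
  size (deletion 𝓕)                                 ≤⟨ size≤C (deletion 𝓕) ⟩
  n C 0                                             ∎
  where
  open ≤-Reasoning
  no-link : length (part inside L) ≡ 0
  no-link = length-All-absurd (λ ()) (part-All inside L uniform)
size≤C {suc n} {suc k} 𝓕 = begin
  size 𝓕                                  ≡⟨ size-split 𝓕 ⟩
  size (link 𝓕) + size (deletion 𝓕)       ≤⟨ +-mono-≤ (size≤C (link 𝓕)) (size≤C (deletion 𝓕)) ⟩
  n C k + n C suc k                       ≡⟨ nCk+nC[k+1]≡[n+1]C[k+1] n k ⟩
  suc n C suc k                           ∎
  where open ≤-Reasoning

_⊕_ : List (Subset n) → List (Subset n) → List (Subset (suc n))
X ⊕ Y = map (inside ∷_) X ++ map (outside ∷_) Y

length-⊕ : (X Y : List (Subset n)) → length (X ⊕ Y) ≡ length X + length Y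
length-⊕ X Y = trans (length-++ (map (inside ∷_) X))
                     (cong₂ _+_ (length-map (inside ∷_) X) (length-map (outside ∷_) Y))

unique-⊕ : {X Y : List (Subset n)} → Unique X → Unique Y → Unique (X ⊕ Y)
unique-⊕ {X = X} {Y} uX uY =
  Unique.++⁺ (Unique.map⁺ ∷-injectiveʳ uX) (Unique.map⁺ ∷-injectiveʳ uY) heads-differ
  where
  heads-differ : ∀ {F} → ¬ (F ∈ₗ map (inside ∷_) X × F ∈ₗ map (outside ∷_) Y)
  heads-differ (F∈X , F∈Y) with ∈-map⁻ (inside ∷_) F∈X | ∈-map⁻ (outside ∷_) F∈Y
  ... | _ , _ , refl | _ , _ , ()

All-⊕ : {P : Subset (suc n) → Set} {X Y : List (Subset n)} →
        All (λ v → P (inside ∷ v)) X → All (λ v → P (outside ∷ v)) Y → All P (X ⊕ Y)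
All-⊕ PX PY = All.++⁺ (All.map⁺ PX) (All.map⁺ PY)

subsetsOfSize : (n r : ℕ) → List (Subset n)
subsetsOfSize zero    zero    = [] ∷ []
subsetsOfSize zero    (suc r) = []
subsetsOfSize (suc n) zero    = [] ⊕ subsetsOfSize n zero
subsetsOfSize (suc n) (suc r) = subsetsOfSize n r ⊕ subsetsOfSize n (suc r)

length-subsetsOfSize : (n r : ℕ) → length (subsetsOfSize n r) ≡ n C r
length-subsetsOfSize zero    zero    = refl
length-subsetsOfSize zero    (suc r) = refl
length-subsetsOfSize (suc n) zero    =
  trans (length-⊕ [] (subsetsOfSize n zero)) (length-subsetsOfSize n zero)
length-subsetsOfSize (suc n) (suc r) = begin
  length (subsetsOfSize n r ⊕ subsetsOfSize n (suc r))
    ≡⟨ length-⊕ (subsetsOfSize n r) (subsetsOfSize n (suc r)) ⟩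
  length (subsetsOfSize n r) + length (subsetsOfSize n (suc r))
    ≡⟨ cong₂ _+_ (length-subsetsOfSize n r) (length-subsetsOfSize n (suc r)) ⟩
  n C r + n C suc r
    ≡⟨ nCk+nC[k+1]≡[n+1]C[k+1] n r ⟩
  suc n C suc r ∎
  where open ≡-Reasoning

unique-subsetsOfSize : (n r : ℕ) → Unique (subsetsOfSize n r)
unique-subsetsOfSize zero    zero    = [] ∷ []
unique-subsetsOfSize zero    (suc r) = []
unique-subsetsOfSize (suc n) zero    = unique-⊕ [] (unique-subsetsOfSize n zero)
unique-subsetsOfSize (suc n) (suc r) =
  unique-⊕ (unique-subsetsOfSize n r) (unique-subsetsOfSize n (suc r))

size-subsetsOfSize : (n r : ℕ) → All (λ F → ∣ F ∣ ≡ r) (subsetsOfSize n r)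
size-subsetsOfSize zero    zero    = refl ∷ []
size-subsetsOfSize zero    (suc r) = []
size-subsetsOfSize (suc n) zero    = All-⊕ [] (size-subsetsOfSize n zero)
size-subsetsOfSize (suc n) (suc r) =
  All-⊕ (All.map (cong suc) (size-subsetsOfSize n r)) (size-subsetsOfSize n (suc r))

-- The r-subsets of [n] meeting the first t points, built like subsetsOfSize.
meeting : (n r t : ℕ) → List (Subset n)
meeting n       r       zero    = []
meeting zero    r       (suc t) = []
meeting (suc n) zero    (suc t) = []
meeting (suc n) (suc r) (suc t) = subsetsOfSize n r ⊕ meeting n (suc r) t

-- Those meeting [t] and those avoiding it (as subsets of the last n-t points)
-- together are all r-subsets.
length-meeting : (n r t : ℕ) → length (meeting n r t) + (n ∸ t) C r ≡ n C r
length-meeting n       r       zero    = refl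
length-meeting zero    r       (suc t) = refl
length-meeting (suc n) zero    (suc t) = refl
length-meeting (suc n) (suc r) (suc t) = begin
  length (subsetsOfSize n r ⊕ meeting n (suc r) t) + (n ∸ t) C suc r
    ≡⟨ cong (_+ (n ∸ t) C suc r) (length-⊕ (subsetsOfSize n r) (meeting n (suc r) t)) ⟩
  length (subsetsOfSize n r) + length (meeting n (suc r) t) + (n ∸ t) C suc r
    ≡⟨ +-assoc (length (subsetsOfSize n r)) _ _ ⟩
  length (subsetsOfSize n r) + (length (meeting n (suc r) t) + (n ∸ t) C suc r)
    ≡⟨ cong₂ _+_ (length-subsetsOfSize n r) (length-meeting n (suc r) t) ⟩
  n C r + n C suc r
    ≡⟨ nCk+nC[k+1]≡[n+1]C[k+1] n r ⟩
  suc n C suc r ∎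
  where open ≡-Reasoning

[n∸t]Cr≤nCr : (n r t : ℕ) → (n ∸ t) C r ≤ n C r
[n∸t]Cr≤nCr n r t =
  ≤-trans (m≤n+m ((n ∸ t) C r) (length (meeting n r t))) (≤-reflexive (length-meeting n r t))

pascal-∸ : (n r t : ℕ) → n C r + (n C suc r ∸ (n ∸ t) C suc r) ≡ suc n C suc r ∸ (n ∸ t) C suc r
pascal-∸ n r t = trans (sym (+-∸-assoc (n C r) ([n∸t]Cr≤nCr n (suc r) t)))
                       (cong (_∸ (n ∸ t) C suc r) (nCk+nC[k+1]≡[n+1]C[k+1] n r))

unique-meeting : (n r t : ℕ) → Unique (meeting n r t)
unique-meeting n       r       zero    = []
unique-meeting zero    r       (suc t) = []
unique-meeting (suc n) zero    (suc t) = []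
unique-meeting (suc n) (suc r) (suc t) = unique-⊕ (unique-subsetsOfSize n r) (unique-meeting n (suc r) t)

size-meeting : (n r t : ℕ) → All (λ F → ∣ F ∣ ≡ r) (meeting n r t)
size-meeting n       r       zero    = []
size-meeting zero    r       (suc t) = []
size-meeting (suc n) zero    (suc t) = []
size-meeting (suc n) (suc r) (suc t) =
  All-⊕ (All.map (cong suc) (size-subsetsOfSize n r)) (size-meeting n (suc r) t)

inFirst : ℕ → Subset m → ℕ
inFirst zero    v             = 0
inFirst (suc t) []            = 0
inFirst (suc t) (inside  ∷ v) = suc (inFirst t v)
inFirst (suc t) (outside ∷ v) = inFirst t v

beyond : ℕ → Subset m → ℕ
beyond zero    v       = ∣ v ∣
beyond (suc t) []      = 0
beyond (suc t) (_ ∷ v) = beyond t v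

∣v∣≡inFirst+beyond : (t : ℕ) (v : Subset m) → ∣ v ∣ ≡ inFirst t v + beyond t v
∣v∣≡inFirst+beyond zero    v             = refl
∣v∣≡inFirst+beyond (suc t) []            = refl
∣v∣≡inFirst+beyond (suc t) (inside  ∷ v) = cong suc (∣v∣≡inFirst+beyond t v)
∣v∣≡inFirst+beyond (suc t) (outside ∷ v) = ∣v∣≡inFirst+beyond t v

inFirst≤t : (t : ℕ) (v : Subset m) → inFirst t v ≤ t
inFirst≤t zero    v             = z≤n
inFirst≤t (suc t) []            = z≤n
inFirst≤t (suc t) (inside  ∷ v) = s≤s (inFirst≤t t v)
inFirst≤t (suc t) (outside ∷ v) = m≤n⇒m≤1+n (inFirst≤t t v)

beyond-∪ : (t : ℕ) (p q : Subset m) → beyond t (p ∪ q) ≤ beyond t p + beyond t q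
beyond-∪ zero    p       q       = ∣p∪q∣≤∣p∣+∣q∣ p q
beyond-∪ (suc t) []      []      = z≤n
beyond-∪ (suc t) (_ ∷ p) (_ ∷ q) = beyond-∪ t p q

beyond-⊥ : (t : ℕ) → beyond t (⊥ {m})  ≡ 0
beyond-⊥ {m}     zero    = ∣⊥∣≡0 m
beyond-⊥ {zero}  (suc t) = refl
beyond-⊥ {suc m} (suc t) = beyond-⊥ {m} t

beyond-⋃ᵛ : (t : ℕ) {s : ℕ} (G : Fin s → Subset m) {c : ℕ} →
            (∀ i → beyond t (G i) ≤ c) → beyond t (⋃ᵛ G) ≤ s * c
beyond-⋃ᵛ t {zero}  G bound = ≤-reflexive (beyond-⊥ t)
beyond-⋃ᵛ t {suc s} G bound =
  ≤-trans (beyond-∪ t (G zero) (⋃ᵛ (G ∘ suc)))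
          (+-mono-≤ (bound zero) (beyond-⋃ᵛ t (G ∘ suc) (bound ∘ suc)))

meeting-union-≤ : (t : ℕ) {s : ℕ} (G : Fin s → Subset m) →
                  (∀ i → ∣ G i ∣ ≡ k) → (∀ i → 1 ≤ inFirst t (G i)) → ∣ ⋃ᵛ G ∣ ≤ t + s * (k ∸ 1)
meeting-union-≤ {k = k} t {s} G size meets = begin
  ∣ ⋃ᵛ G ∣                                ≡⟨ ∣v∣≡inFirst+beyond t (⋃ᵛ G) ⟩
  inFirst t (⋃ᵛ G) + beyond t (⋃ᵛ G)      ≤⟨ +-mono-≤ (inFirst≤t t (⋃ᵛ G)) (beyond-⋃ᵛ t G beyond≤) ⟩
  t + s * (k ∸ 1)                         ∎
  where
  open ≤-Reasoning
  beyond≤ : ∀ i → beyond t (G i) ≤ k ∸ 1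
  beyond≤ i = begin
    beyond t (G i)                                  ≡⟨ m+n∸m≡n (inFirst t (G i)) _ ⟨
    inFirst t (G i) + beyond t (G i) ∸ inFirst t (G i)
      ≡⟨ cong (_∸ inFirst t (G i)) (trans (sym (∣v∣≡inFirst+beyond t (G i))) (size i)) ⟩
    k ∸ inFirst t (G i)                             ≤⟨ ∸-monoʳ-≤ k (meets i) ⟩
    k ∸ 1                                           ∎

meets-meeting : (n r t : ℕ) → All (λ F → 1 ≤ inFirst t F) (meeting n r t)
meets-meeting n       r       zero    = []
meets-meeting zero    r       (suc t) = []
meets-meeting (suc n) zero    (suc t) = []
meets-meeting (suc n) (suc r) (suc t) = All-⊕ (All.tabulate (λ _ → s≤s z≤n)) (meets-meeting n (suc r) t)

meetingFamily : (n r t : ℕ) → Family n r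
meetingFamily n r t = family (meeting n r t) (unique-meeting n r t) (size-meeting n r t)

meeting-U : (n r t : ℕ) → PropU s (t + s * (r ∸ 1)) (meetingFamily n r t)
meeting-U n r t G G∈ =
  meeting-union-≤ t G (All.lookup (size-meeting n r t) ∘ G∈) (All.lookup (meets-meeting n r t) ∘ G∈)

size-meetingFamily : (n r t : ℕ) → size (meetingFamily n r t) ≡ n C r ∸ (n ∸ t) C r
size-meetingFamily n r t = begin
  length (meeting n r t)                              ≡⟨ m+n∸n≡m (length (meeting n r t)) ((n ∸ t) C r) ⟨
  length (meeting n r t) + (n ∸ t) C r ∸ (n ∸ t) C r  ≡⟨ cong (_∸ (n ∸ t) C r) (length-meeting n r t) ⟩
  n C r ∸ (n ∸ t) C r                                 ∎
  where open ≡-Reasoning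

_∈?ₗ_ : (F : Subset m) (L : List (Subset m)) → Dec (F ∈ₗ L)
_∈?ₗ_ {m} = DecMembership._∈?_ (≡-dec {n = m} Bool._≟_)

Movable : List (Subset (suc n)) → Fin n → Subset n → Set
Movable L y v = y ∈ v × moveTo0 v y ∉ₗ L

movable? : (L : List (Subset (suc n))) (y : Fin n) (v : Subset n) → Dec (Movable L y v)
movable? L y v = (y ∈? v) ×-dec ¬? (moveTo0 v y ∈?ₗ L)

not-movable : {L : List (Subset (suc n))} {y : Fin n} {v : Subset n} →
              y ∈ v → ¬ Movable L y v → moveTo0 v y ∈ₗ L
not-movable {L = L} {y} {v} y∈v ¬mov = decidable-stable (moveTo0 v y ∈?ₗ L) (λ ∉L → ¬mov (y∈v , ∉L))

Stable : List (Subset (suc n)) → Set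
Stable L = ∀ {v} y → outside ∷ v ∈ₗ L → y ∈ v → moveTo0 v y ∈ₗ L

stable-or-movable : (L : List (Subset (suc n))) →
                    Stable L ⊎ ∃[ y ] ∃[ v ] outside ∷ v ∈ₗ L × Movable L y v
stable-or-movable L with Any.any? (λ v → any? (λ y → movable? L y v)) (part outside L)
... | yes some = let v , v∈ , y , mov = find some in inj₂ (y , v , ∈-part⁻ outside L v∈ , mov)
... | no none  = inj₁ λ y v∈L y∈v →
  not-movable y∈v (λ mov → none (lose (∈-part⁺ outside L v∈L) (y , mov)))

misses0 : Subset (suc n) → ℕ
misses0 (inside  ∷ _) = 0
misses0 (outside ∷ _) = 1

avoiding0 : List (Subset (suc n)) → ℕ
avoiding0 L = sum (map misses0 L)

module Shift {n : ℕ} (L : List (Subset (suc n))) (y : Fin n) where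

  shiftWith : (v : Subset n) → Dec (Movable L y v) → Subset (suc n)
  shiftWith v (yes _) = moveTo0 v y
  shiftWith v (no  _) = outside ∷ v

  shift : Subset (suc n) → Subset (suc n)
  shift (inside  ∷ v) = inside ∷ v
  shift (outside ∷ v) = shiftWith v (movable? L y v)

  data ShiftView : Subset (suc n) → Set where
    fixed : ∀ {F} → shift F ≡ F → (∀ {v} → F ≡ outside ∷ v → ¬ Movable L y v) → ShiftView F
    moved : ∀ {v} → Movable L y v → shift (outside ∷ v) ≡ moveTo0 v y → ShiftView (outside ∷ v)

  view : ∀ F → ShiftView F
  view (inside ∷ v) = fixed refl (λ ())
  view (outside ∷ v) with movable? L y v in decision
  ... | yes mov  = moved mov (cong (shiftWith v) decision)
  ... | no  ¬mov = fixed (cong (shiftWith v) decision) (λ { refl → ¬mov })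

  shift-moves : {v : Subset n} → Movable L y v → shift (outside ∷ v) ≡ moveTo0 v y
  shift-moves {v} mov with view (outside ∷ v)
  ... | fixed _ ¬mov = contradiction mov (¬mov refl)
  ... | moved _ moves = moves

  size-shift : ∀ F → ∣ shift F ∣ ≡ ∣ F ∣
  size-shift F with view F
  ... | fixed fixes _         = cong ∣_∣ fixes
  ... | moved (y∈v , _) moves = trans (cong ∣_∣ moves) (suc∣p-x∣≡∣p∣ y∈v)

  -- A moved set is new, so the shift is injective on L.
  shift-injective : ∀ {F G} → F ∈ₗ L → G ∈ₗ L → shift F ≡ shift G → F ≡ G
  shift-injective {F} {G} F∈L G∈L eq with view F | view G
  ... | fixed fixesF _ | fixed fixesG _ = trans (sym fixesF) (trans eq fixesG)
  ... | moved (y∈v , _) movesF | moved (y∈w , _) movesG =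
    cong (outside ∷_) (-x-injective y∈v y∈w (∷-injectiveʳ (trans (sym movesF) (trans eq movesG))))
  ... | moved (_ , new) movesF | fixed fixesG _ =
    contradiction (subst (_∈ₗ L) (trans (sym fixesG) (trans (sym eq) movesF)) G∈L) new
  ... | fixed fixesF _ | moved (_ , new) movesG =
    contradiction (subst (_∈ₗ L) (trans (sym fixesF) (trans eq movesG)) F∈L) new

  misses0-shift : ∀ F → misses0 (shift F) ≤ misses0 F
  misses0-shift F with view F
  ... | fixed fixes _ = ≤-reflexive (cong misses0 fixes)
  ... | moved _ moves = ≤-trans (≤-reflexive (cong misses0 moves)) z≤n

  avoiding0-shift-≤ : ∀ L′ → avoiding0 (map shift L′) ≤ avoiding0 L′
  avoiding0-shift-≤ []       = z≤n
  avoiding0-shift-≤ (F ∷ L′) = +-mono-≤ (misses0-shift F) (avoiding0-shift-≤ L′)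

  avoiding0-shift-< : ∀ L′ {v} → outside ∷ v ∈ₗ L′ → Movable L y v →
                      avoiding0 (map shift L′) < avoiding0 L′
  avoiding0-shift-< (_ ∷ L′) (here refl) mov rewrite shift-moves mov = s≤s (avoiding0-shift-≤ L′)
  avoiding0-shift-< (F ∷ L′) (there v∈) mov = +-mono-≤-< (misses0-shift F) (avoiding0-shift-< L′ v∈ mov)

  shift-⊆ : ∀ F {x} → suc x ∈ shift F → suc x ∈ F
  shift-⊆ F {x} sx∈ with view F
  ... | fixed fixes _ = subst (suc x ∈_) fixes sx∈
  ... | moved {v} _ moves = thereˢ (p─q⊆p v ⁅ y ⁆ (drop-there (subst (suc x ∈_) moves sx∈)))

  shift-gains-0 : ∀ F → zero ∈ shift F → zero ∉ F → suc y ∈ F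
  shift-gains-0 F 0∈ 0∉ with view F
  ... | fixed fixes _       = contradiction (subst (zero ∈_) fixes 0∈) 0∉
  ... | moved (y∈v , _) _   = thereˢ y∈v

  shift-keeps-y : ∀ F → suc y ∈ shift F → zero ∉ F →
                  shift F ≡ F × ∃[ u ] F ≡ outside ∷ u × moveTo0 u y ∈ₗ L
  shift-keeps-y F sy∈ 0∉ with view F
  ... | moved {v} _ moves = contradiction (drop-there (subst (suc y ∈_) moves sy∈)) (x∉p-x y v)
  ... | fixed fixes ¬mov with ∉0⇒outside F 0∉
  ...   | u , refl = fixes , u , refl , not-movable (drop-there (subst (suc y ∈_) fixes sy∈)) (¬mov refl)

  -- The shift preserves property U(s,q): for shifted sets G i = shift (F i) with
  -- F i ∈ L, the union ⋃G lies in ⋃F (if 0 ∈ ⋃F or 0 ∉ ⋃G), or in ⋃F with y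
  -- traded for 0 (if y ∉ ⋃G), or else in the union of F with one member moved.
  shift-preserves-U : UnionBound s q L → UnionBound s q (map shift L)
  shift-preserves-U {s} {q} U G G∈ = bound
    where
    preimage : ∀ i → ∃[ F ] F ∈ₗ L × G i ≡ shift F
    preimage i = ∈-map⁻ shift (G∈ i)
    F : Fin s → Subset (suc n)
    F i = proj₁ (preimage i)
    F∈L : ∀ i → F i ∈ₗ L
    F∈L i = proj₁ (proj₂ (preimage i))
    G≡ : ∀ i → G i ≡ shift (F i)
    G≡ i = proj₂ (proj₂ (preimage i))

    away-from-0 : ∀ {x} → suc x ∈ ⋃ᵛ G → suc x ∈ ⋃ᵛ F
    away-from-0 {x} sx∈⋃G =
      let i , sx∈Gi = ∈⋃ᵛ⁻ G sx∈⋃G in ∈⋃ᵛ⁺ F i (shift-⊆ (F i) (subst (suc x ∈_) (G≡ i) sx∈Gi))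

    -- Some G j gained 0 although 0 ∉ ⋃F; then F j was moved, so it contained y.
    gained0 : zero ∉ ⋃ᵛ F → (j : Fin s) → zero ∈ G j → ∣ ⋃ᵛ G ∣ ≤ q
    gained0 0∉⋃F j 0∈Gj = by-y (suc y ∈? ⋃ᵛ G)
      where
      sy∈Fj : suc y ∈ F j
      sy∈Fj = shift-gains-0 (F j) (subst (zero ∈_) (G≡ j) 0∈Gj) (0∉⋃F ∘ ∈⋃ᵛ⁺ F j)

      by-y : Dec (suc y ∈ ⋃ᵛ G) → ∣ ⋃ᵛ G ∣ ≤ q
      -- y is no longer covered: ⋃G ⊆ {0} ∪ (⋃F - y).
      by-y (no sy∉⋃G) = ≤-trans (exchange-≤ {x = zero} (∈⋃ᵛ⁺ F j sy∈Fj) traded) (U F F∈L)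
        where
        traded : ⋃ᵛ G ⊆ ⁅ zero ⁆ ∪ (⋃ᵛ F - suc y)
        traded = ⊆-split (λ _ → x∈p∪q⁺ (inj₁ (x∈⁅x⁆ zero)))
                         (λ sx∈ → x∈p∪q⁺ {p = ⁅ zero ⁆} (inj₂ (x∈p∧x≢y⇒x∈p-y {y = suc y}
                                    (away-from-0 sx∈) (λ { refl → sy∉⋃G sx∈ }))))
      -- y is still covered by a fixed G i = F i ∌ 0 whose move lies in L; moving
      -- y to 0 in F i covers ⋃G.
      by-y (yes sy∈⋃G) with ∈⋃ᵛ⁻ G sy∈⋃G
      ... | i , sy∈Gi with shift-keeps-y (F i) (subst (suc y ∈_) (G≡ i) sy∈Gi) (0∉⋃F ∘ ∈⋃ᵛ⁺ F i)
      ...   | fixes , u , Fi≡ , moved∈L with move-covers F i≢j Fi≡ sy∈Fj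
        where
        i≢j : i ≢ j
        i≢j refl = 0∉⋃F (∈⋃ᵛ⁺ F i (subst (zero ∈_) (trans (G≡ i) fixes) 0∈Gj))
      ...     | 0∈⋃F′ , ⋃F⊆⋃F′ = covered-≤ U (updateAt F i (const (moveTo0 u y)))
                                    (updateAt-∈ F i F∈L moved∈L) (⊆-split (const 0∈⋃F′) (⋃F⊆⋃F′ ∘ away-from-0))

    bound : ∣ ⋃ᵛ G ∣ ≤ q
    bound with zero ∈? ⋃ᵛ F | zero ∈? ⋃ᵛ G
    ... | yes 0∈⋃F | _        = covered-≤ U F F∈L (⊆-split (const 0∈⋃F) away-from-0)
    ... | no  _    | no 0∉⋃G  = covered-≤ U F F∈L (⊆-split (λ 0∈⋃G → contradiction 0∈⋃G 0∉⋃G) away-from-0)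
    ... | no 0∉⋃F  | yes 0∈⋃G = let j , 0∈Gj = ∈⋃ᵛ⁻ G 0∈⋃G in gained0 0∉⋃F j 0∈Gj

shiftFamily : Family (suc n) k → Fin n → Family (suc n) k
shiftFamily (family L unique uniform) y =
  family (map shift L) (map-unique shift-injective unique)
         (All.map⁺ (All.map (λ {F} ∣F∣≡k → trans (size-shift F) ∣F∣≡k) uniform))
  where open Shift L y

-- In a stable k-uniform family with U(s,q+1), where q+1 < sk, the deletion of 0
-- has U(s,q): s of its members are not pairwise disjoint, and moving a shared
-- point to 0 in one of them gives s members whose union has one point more.
deletion-U : (𝓕 : Family (suc n) k) → Stable (Family.members 𝓕) → PropU s (suc q) 𝓕 →
             suc q < s * k → PropU s q (deletion 𝓕)
deletion-U {n = n} {s = s} {q = q} 𝓕@(family L _ _) stable U q+1<sk G G∈ = bound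
  where
  F : Fin s → Subset (suc n)
  F i = outside ∷ G i
  F∈L : ∀ i → F i ∈ₗ L
  F∈L i = ∈-part⁻ outside L (G∈ i)
  bound : ∣ ⋃ᵛ G ∣ ≤ q
  bound with overlap-or-disjoint G (All.lookup (Family.uniform (deletion 𝓕)) ∘ G∈)
  ... | inj₂ ∣⋃G∣≡sk =
    contradiction (subst (_≤ suc q) (trans (cong ∣_∣ (⋃ᵛ-outside G)) ∣⋃G∣≡sk) (U F F∈L)) (<⇒≱ q+1<sk)
  ... | inj₁ (i , j , x , i≢j , x∈Gi , x∈Gj) with move-covers F i≢j refl (thereˢ x∈Gj)
  ...   | 0∈⋃F′ , ⋃F⊆⋃F′ =
    ≤-pred (covered-≤ U (updateAt F i (const (moveTo0 (G i) x)))
                      (updateAt-∈ F i F∈L (stable x (F∈L i) x∈Gi)) 0∪⋃G⊆⋃F′)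
    where
    0∪⋃G⊆⋃F′ : inside ∷ ⋃ᵛ G ⊆ ⋃ᵛ (updateAt F i (const (moveTo0 (G i) x)))
    0∪⋃G⊆⋃F′ = ⊆-split (const 0∈⋃F′)
                 (λ sz∈ → ⋃F⊆⋃F′ (subst (_ ∈_) (sym (⋃ᵛ-outside G)) (thereˢ (drop-there sz∈))))

-- Shift until stable (by induction on the number of members
-- avoiding 0), then count the link and the deletion of 0.
upper-bound : {V : ℕ} → suc q < s * suc r → ((𝓕 : Family n (suc r)) → PropU s q 𝓕 → size 𝓕 ≤ V) →
              (𝓕 : Family (suc n) (suc r)) → PropU s (suc q) 𝓕 → size 𝓕 ≤ n C r + V
upper-bound {q} {s} {r} {n} {V} q+1<sk maxV 𝓕 = go (suc (avoiding0 (Family.members 𝓕))) 𝓕 ≤-refl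
  where
  go : ∀ N (𝓖 : Family (suc n) (suc r)) → avoiding0 (Family.members 𝓖) < N → PropU s (suc q) 𝓖 →
       size 𝓖 ≤ n C r + V
  go zero    _ () _
  go (suc N) 𝓖@(family L _ _) a<N U with stable-or-movable L
  ... | inj₁ stable = begin
    size 𝓖                              ≡⟨ size-split 𝓖 ⟩
    size (link 𝓖) + size (deletion 𝓖)   ≤⟨ +-mono-≤ (size≤C (link 𝓖))
                                                     (maxV (deletion 𝓖) (deletion-U 𝓖 stable U q+1<sk)) ⟩
    n C r + V                           ∎
    where open ≤-Reasoning
  ... | inj₂ (y , v , v∈L , mov) = begin
    length L                            ≡⟨ length-map shift L ⟨
    length (map shift L)                ≤⟨ go N (shiftFamily 𝓖 y) shifted<N (shift-preserves-U U) ⟩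
    n C r + V                           ∎
    where
    open ≤-Reasoning
    open Shift L y
    shifted<N : avoiding0 (map shift L) < N
    shifted<N = <-≤-trans (avoiding0-shift-< L v∈L mov) (≤-pred a<N)

proposition1 : (n k s p : ℕ) → 2 ≤ s → 1 ≤ p
    → Defined n k s ((k ∸ 1) * s + p)
    → Defined (suc n) k s ((k ∸ 1) * s + p + 1)
    → IsM n k s ((k ∸ 1) * s + p) ((n C k) ∸ ((n ∸ p) C k))
    → IsM (suc n) k s ((k ∸ 1) * s + p + 1) ((suc n C k) ∸ ((n ∸ p) C k))
-- k = 0 is excluded by q < s·0.  Otherwise m(n+1,k,s,Q+1) is attained by the sets
-- meeting the first p+1 points and bounded by C(n,k-1) + m(n,k,s,Q).
proposition1 n zero s p _ _ _ (_ , _ , q<s*0 , _) _ =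
  contradiction (<-≤-trans q<s*0 (≤-reflexive (*-zeroʳ s))) (λ ())
proposition1 n (suc k) s p _ _ _ (_ , _ , Q+1<sk , _) (_ , maxV) =
  (𝓜 , 𝓜-U , size-meetingFamily (suc n) (suc k) (suc p)) , upper
  where
  Q = k * s + p
  𝓜 = meetingFamily (suc n) (suc k) (suc p)
  p+1+sk≡Q+1 : ∀ p s k → suc p + s * k ≡ k * s + p + 1
  p+1+sk≡Q+1 = solve-∀
  𝓜-U : PropU s (Q + 1) 𝓜
  𝓜-U = subst (λ q → PropU s q 𝓜) (p+1+sk≡Q+1 p s k) (meeting-U (suc n) (suc k) (suc p))
  Q+1≡1+Q : Q + 1 ≡ suc Q
  Q+1≡1+Q = +-comm Q 1
  upper : (𝓕 : Family (suc n) (suc k)) → PropU s (Q + 1) 𝓕 → size 𝓕 ≤ suc n C suc k ∸ (n ∸ p) C suc k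
  upper 𝓕 U = begin
    size 𝓕                                ≤⟨ upper-bound (subst (_< s * suc k) Q+1≡1+Q Q+1<sk) maxV 𝓕
                                                         (subst (λ q → PropU s q 𝓕) Q+1≡1+Q U) ⟩
    n C k + (n C suc k ∸ (n ∸ p) C suc k)  ≡⟨ pascal-∸ n k p ⟩
    suc n C suc k ∸ (n ∸ p) C suc k        ∎
    where open ≤-Reasoning
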